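{- Let $t\geq 1$ be an integer and let $\{ (A_i, B_i ) : i \in I\}$ be a finite collection of pairs of finite sets such that (a) $|A_i \cap B_i| \leq t$ for each $i \in I$; (b) $|A_i \cap B_j| \geq t$ for all $i, j \in I$ with $i \neq j$; (c') for $i \neq j$ with $A_i \cap B_i = A_j \cap B_j$, it is not the case that $A_i \cap B_j = A_i \cap B_i = A_j \cap B_i$. Then $$\sum_{i \in I}\binom{|A_i \cup B_i |}{|A_i - B_i |}^{ -1} \binom{|B_i |}{|A_i \cap B_i |}^{ -1} \leq 1.$$ -}

module Defs where

open import Data.Nat using (ℕ; zero; suc)
open import Data.Integer using (+_)
open import Data.Fin using (Fin; zero; suc)
open import Data.Rational using (ℚ; 0ℚ; _+_; _/_)

-- reciprocal of a natural number as a rational (only ever applied to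
-- binomial coefficients that are positive; the 0 case is a dummy value)
recip : ℕ → ℚ
recip zero    = 0ℚ
recip (suc k) = + 1 / suc k

∑ : (m : ℕ) → (Fin m → ℚ) → ℚ
∑ zero    f = 0ℚ
∑ (suc m) f = f zero + ∑ m (λ i → f (suc i))

module Submission where

-- Theorem 1.9, by Lubell's method of counting orderings.
--
-- Say that an ordering of the n points respects the pair (A , B) when all of
-- A ─ B comes before all of A ∩ B, and all of A ∩ B before all of B ─ A.  Of
-- the n! orderings exactly n! / (C(|A ∪ B|, |A ─ B|) · C(|B|, |A ∩ B|)) respect
-- (A , B), and under (a), (b) and (c') no ordering respects two different
-- pairs.  Hence the orderings counted for the different pairs are distinct,
-- and the sum of the fractions in the theorem is at most 1.

open import Defs

open import Data.Bool.Base using (if_then_else_)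
open import Data.Maybe.Base using (Maybe; just; nothing)
open import Data.Empty using (⊥)
open import Data.Fin.Base using (Fin; zero; suc)
import Data.Fin.Properties as Fin
open import Data.Fin.Subset renaming (⊥ to ∅)
open import Data.Fin.Subset.Properties
open import Data.Nat.Base using (ℕ; NonZero; zero; suc; pred; _+_; _*_; _∸_; _≤_; _≥_; _<_; z≤n; s≤s; _!)
open import Data.Nat.Combinatorics using (_C_; nCk≡n!/k![n-k]!; k![n∸k]!∣n!)
open import Data.Nat.DivMod using (m/n*n≡m)
open import Data.Nat.Properties
open import Data.Nat.Tactic.RingSolver using (solve-∀)
open import Data.Product.Base using (Σ; _×_; _,_; proj₁; proj₂)
open import Data.Sum.Base using (_⊎_; inj₁; inj₂; [_,_]′)
open import Function.Base using (_∘_)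
open import Data.Vec.Base using ([]; _∷_; here; there)
open import Relation.Binary.PropositionalEquality
open import Relation.Nullary using (¬_; Dec; yes; no; does; contradiction; _×-dec_; _→-dec_)
open import Relation.Nullary.Decidable using (dec-true; dec-false)
open import Data.Rational.Base using (ℚ; 1ℚ) renaming (_*_ to _*ℚ_; _≤_ to _≤ℚ_)
open import Algebra.Properties.Semiring.Sum +-*-semiring using (sum; ∑-comm; ∑-distrib-+; *-distribˡ-sum; *-distribʳ-sum; sum-cong-≋)

private variable
  n m : ℕ
  x : Fin n
  p q : Subset n

sum-mono : ∀ (f g : Fin m → ℕ) → (∀ i → f i ≤ g i) → sum f ≤ sum g
sum-mono {zero} f g f≤g = z≤n
sum-mono {suc m} f g f≤g = +-mono-≤ (f≤g zero) (sum-mono (λ i → f (suc i)) (λ i → g (suc i)) (λ i → f≤g (suc i)))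

sum-zero : ∀ (f : Fin m → ℕ) → (∀ i → f i ≡ 0) → sum f ≡ 0
sum-zero {zero} f f≡0 = refl
sum-zero {suc m} f f≡0 = cong₂ _+_ (f≡0 zero) (sum-zero (λ i → f (suc i)) (λ i → f≡0 (suc i)))

term≤sum : ∀ (f : Fin m → ℕ) i → f i ≤ sum f
term≤sum f zero = m≤m+n (f zero) _
term≤sum f (suc i) = ≤-trans (term≤sum (λ j → f (suc j)) i) (m≤n+m _ (f zero))

sum≤1 : ∀ (f : Fin m → ℕ) → (∀ i → f i ≤ 1) → (∀ i j → 1 ≤ f i → 1 ≤ f j → i ≡ j) → sum f ≤ 1
sum≤1 {zero} f f≤1 unique = z≤n
sum≤1 {suc m} f f≤1 unique with f zero in eq
... | zero = sum≤1 (λ i → f (suc i)) (λ i → f≤1 (suc i)) (λ i j fi fj → Fin.suc-injective (unique (suc i) (suc j) fi fj))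
... | suc k = begin
  suc k + sum (λ i → f (suc i))  ≡⟨ cong (suc k +_) (sum-zero (λ i → f (suc i)) rest≡0) ⟩
  suc k + 0                      ≡⟨ +-identityʳ (suc k) ⟩
  suc k                          ≡⟨ eq ⟨
  f zero                         ≤⟨ f≤1 zero ⟩
  1                              ∎
  where
  open ≤-Reasoning
  1≤-of-suc : ∀ {a b} → a ≡ suc b → 1 ≤ a
  1≤-of-suc refl = s≤s z≤n
  rest≡0 : ∀ i → f (suc i) ≡ 0
  rest≡0 i with f (suc i) in eqᵢ
  ... | zero = refl
  ... | suc _ with unique zero (suc i) (1≤-of-suc eq) (1≤-of-suc eqᵢ)
  ... | ()

𝟙 : Subset n → Fin n → ℕ
𝟙 p x = if does (x ∈? p) then 1 else 0

𝟙-∈ : x ∈ p → 𝟙 p x ≡ 1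
𝟙-∈ {x = x} {p = p} x∈p rewrite dec-true (x ∈? p) x∈p = refl

𝟙-∉ : x ∉ p → 𝟙 p x ≡ 0
𝟙-∉ {x = x} {p = p} x∉p rewrite dec-false (x ∈? p) x∉p = refl

∣p∣≡∑𝟙 : ∀ (p : Subset n) → ∣ p ∣ ≡ sum (𝟙 p)
∣p∣≡∑𝟙 [] = refl
∣p∣≡∑𝟙 (inside ∷ p) = cong suc (∣p∣≡∑𝟙 p)
∣p∣≡∑𝟙 (outside ∷ p) = ∣p∣≡∑𝟙 p

∑∈ : Subset n → (Fin n → ℕ) → ℕ
∑∈ p f = sum (λ x → 𝟙 p x * f x)

∑∈-cong : ∀ (p : Subset n) {f g : Fin n → ℕ} → (∀ {x} → x ∈ p → f x ≡ g x) → ∑∈ p f ≡ ∑∈ p g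
∑∈-cong p {f} {g} f≡g = sum-cong-≋ guarded
  where
  guarded : ∀ x → 𝟙 p x * f x ≡ 𝟙 p x * g x
  guarded x with x ∈? p
  ... | yes x∈p = cong (1 *_) (f≡g x∈p)
  ... | no _ = refl

∑∈-mono : ∀ (p : Subset n) {f g : Fin n → ℕ} → (∀ {x} → x ∈ p → f x ≤ g x) → ∑∈ p f ≤ ∑∈ p g
∑∈-mono p {f} {g} f≤g = sum-mono _ _ guarded
  where
  guarded : ∀ x → 𝟙 p x * f x ≤ 𝟙 p x * g x
  guarded x with x ∈? p
  ... | yes x∈p = *-monoʳ-≤ 1 (f≤g x∈p)
  ... | no _ = z≤n

∑∈-const : ∀ (p : Subset n) {f : Fin n → ℕ} c → (∀ {x} → x ∈ p → f x ≡ c) → ∑∈ p f ≡ ∣ p ∣ * c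
∑∈-const p c f≡c = begin
  ∑∈ p _             ≡⟨ ∑∈-cong p f≡c ⟩
  ∑∈ p (λ _ → c)     ≡⟨ *-distribʳ-sum c (𝟙 p) ⟨
  sum (𝟙 p) * c      ≡⟨ cong (_* c) (∣p∣≡∑𝟙 p) ⟨
  ∣ p ∣ * c          ∎
  where open ≡-Reasoning

∑∈-zero : ∀ (p : Subset n) {f : Fin n → ℕ} → (∀ {x} → x ∈ p → f x ≡ 0) → ∑∈ p f ≡ 0
∑∈-zero p f≡0 = trans (∑∈-const p 0 f≡0) (*-zeroʳ ∣ p ∣)

∑∈-*ʳ : ∀ (p : Subset n) (f : Fin n → ℕ) c → ∑∈ p f * c ≡ ∑∈ p (λ x → f x * c)
∑∈-*ʳ p f c = trans (*-distribʳ-sum c (λ x → 𝟙 p x * f x)) (sum-cong-≋ (λ x → *-assoc (𝟙 p x) (f x) c))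

x∈p─q⇒x∉q : ∀ (p q : Subset n) → x ∈ p ─ q → x ∉ q
x∈p─q⇒x∉q (_ ∷ p) (inside ∷ q) (there x∈p─q) (there x∈q) = x∈p─q⇒x∉q p q x∈p─q x∈q
x∈p─q⇒x∉q (_ ∷ p) (outside ∷ q) (there x∈p─q) (there x∈q) = x∈p─q⇒x∉q p q x∈p─q x∈q

x∈p⇒0<∣p∣ : x ∈ p → 0 < ∣ p ∣
x∈p⇒0<∣p∣ x∈p = ≤-trans (s≤s z≤n) (x∈p⇒∣p-x∣<∣p∣ x∈p)

∣p∣≡0⇒x∉p : ∣ p ∣ ≡ 0 → x ∉ p
∣p∣≡0⇒x∉p ∣p∣≡0 x∈p = <-irrefl (sym ∣p∣≡0) (x∈p⇒0<∣p∣ x∈p)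

0<∣p∣⇒Nonempty : ∀ {n} {p : Subset n} → 0 < ∣ p ∣ → Nonempty p
0<∣p∣⇒Nonempty {n} {p} 0<∣p∣ with nonempty? p
... | yes ne = ne
... | no empty = contradiction (trans (cong ∣_∣ (Empty-unique empty)) (∣⊥∣≡0 n)) (>⇒≢ 0<∣p∣)

Nonempty─⊎⊆ : ∀ (p q : Subset n) → Nonempty (p ─ q) ⊎ p ⊆ q
Nonempty─⊎⊆ p q with nonempty? (p ─ q)
... | yes ne = inj₁ ne
... | no empty = inj₂ p⊆q
  where
  p⊆q : p ⊆ q
  p⊆q {x} x∈p with x ∈? q
  ... | yes x∈q = x∈q
  ... | no x∉q = contradiction (x , x∈p∧x∉q⇒x∈p─q x∈p x∉q) empty

⊆-by-size : p ⊆ q → ∣ q ∣ ≤ ∣ p ∣ → p ≡ q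
⊆-by-size {p = p} {q = q} p⊆q ∣q∣≤∣p∣ = ⊆-antisym p⊆q q⊆p
  where
  q⊆p : q ⊆ p
  q⊆p {x} x∈q with x ∈? p
  ... | yes x∈p = x∈p
  ... | no x∉p = contradiction ∣q∣≤∣p∣ (<⇒≱ (p⊂q⇒∣p∣<∣q∣ (p⊆q , x , x∈q , x∉p)))

size-cases : ∀ (p : Subset n) → ∣ p ∣ ≡ 0 ⊎ Σ ℕ (λ ℓ → ∣ p ∣ ≡ suc ℓ)
size-cases p with ∣ p ∣
... | zero = inj₁ refl
... | suc ℓ = inj₂ (ℓ , refl)

x∉p-x : ∀ (p : Subset n) → x ∉ p - x
x∉p-x {x = x} p x∈p-x = x∈p─q⇒x∉q p ⁅ x ⁆ x∈p-x (x∈⁅x⁆ x)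

p⊆q⇒p-x⊆q-x : p ⊆ q → p - x ⊆ q - x
p⊆q⇒p-x⊆q-x {p = p} {q = q} {x = x} p⊆q {y} y∈p-x =
  x∈p∧x≢y⇒x∈p-y (p⊆q (p─q⊆p p ⁅ x ⁆ y∈p-x)) (λ { refl → x∉p-x p y∈p-x })

p-x≡p : ∀ (p : Subset n) → x ∉ p → p - x ≡ p
p-x≡p {x = zero} (inside ∷ p) x∉p = contradiction here x∉p
p-x≡p {x = zero} (outside ∷ p) x∉p = cong (outside ∷_) (p─⊥≡p p)
p-x≡p {x = suc x} (s ∷ p) x∉p = cong (s ∷_) (p-x≡p p (x∉p ∘ there))

∣p-x∣≡∣p∣ : ∀ (p : Subset n) → x ∉ p → ∣ p - x ∣ ≡ ∣ p ∣
∣p-x∣≡∣p∣ p x∉p = cong ∣_∣ (p-x≡p p x∉p)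

∣p-x∣+1≡∣p∣ : ∀ (p : Subset n) → x ∈ p → suc ∣ p - x ∣ ≡ ∣ p ∣
∣p-x∣+1≡∣p∣ {x = zero} (inside ∷ p) here = cong (suc ∘ ∣_∣) (p─⊥≡p p)
∣p-x∣+1≡∣p∣ {x = suc x} (inside ∷ p) (there x∈p) = cong suc (∣p-x∣+1≡∣p∣ p x∈p)
∣p-x∣+1≡∣p∣ {x = suc x} (outside ∷ p) (there x∈p) = ∣p-x∣+1≡∣p∣ p x∈p

-- Block patterns and the orderings that respect them

-- A pattern (X , Y , Z) of blocks asks for all of X before all of Y and all
-- of Y before all of Z; the orderings are given by rank functions.
Pattern : ℕ → Set
Pattern n = Subset n × Subset n × Subset n

size : Pattern n → ℕ
size (X , Y , Z) = ∣ X ∣ + (∣ Y ∣ + ∣ Z ∣)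

weight : Pattern n → ℕ
weight (X , Y , Z) = ∣ X ∣ ! * (∣ Y ∣ ! * ∣ Z ∣ !)

_⊖_ : Pattern n → Fin n → Pattern n
(X , Y , Z) ⊖ x = X - x , Y - x , Z - x

Precedes : (Fin n → ℕ) → Subset n → Subset n → Set
Precedes r p q = ∀ {u v} → u ∈ p → v ∈ q → r u < r v

-- r respects a pattern; nothing stands for a pattern that is already violated
Respects : (Fin n → ℕ) → Maybe (Pattern n) → Set
Respects r nothing = ⊥
Respects r (just (X , Y , Z)) = Precedes r X Y × Precedes r Y Z × Precedes r X Z

-- x may come last among the elements still to be ordered: no block after the
-- block of x has elements left
CanBeLast : Fin n → Pattern n → Set
CanBeLast x (X , Y , Z) = (x ∈ Y → ∣ Z ∣ ≡ 0) × (x ∈ X → ∣ Y ∣ + ∣ Z ∣ ≡ 0)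

canBeLast? : ∀ (x : Fin n) P → Dec (CanBeLast x P)
canBeLast? x (X , Y , Z) = (x ∈? Y →-dec ∣ Z ∣ ≟ 0) ×-dec (x ∈? X →-dec ∣ Y ∣ + ∣ Z ∣ ≟ 0)

removeLast : Fin n → Maybe (Pattern n) → Maybe (Pattern n)
removeLast x nothing = nothing
removeLast x (just P) with canBeLast? x P
... | yes _ = just (P ⊖ x)
... | no _ = nothing

-- orderings k S P counts the orderings of the k-element set S that respect
-- P, built by choosing the last element and then ordering the rest
orderings : ℕ → Subset n → Maybe (Pattern n) → ℕ
orderings zero S nothing = 0
orderings zero S (just P) with size P ≟ 0
... | yes _ = 1
... | no _ = 0
orderings (suc k) S P = ∑∈ S (λ x → orderings k (S - x) (removeLast x P))

extendLast : (Fin n → ℕ) → Fin n → Fin n → ℕ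
extendLast r x y = if does (y Fin.≟ x) then suc (sum r) else r y

precedes-extendLast : ∀ (r : Fin n → ℕ) x → Precedes r (p - x) (q - x) →
  (x ∈ p → ∣ q ∣ ≡ 0) → Precedes (extendLast r x) p q
precedes-extendLast r x prec x-last {u} {v} u∈p v∈q with u Fin.≟ x | v Fin.≟ x
... | yes refl | _ = contradiction v∈q (∣p∣≡0⇒x∉p (x-last u∈p))
... | no u≢x | yes refl = s≤s (term≤sum r u)
... | no u≢x | no v≢x = prec (x∈p∧x≢y⇒x∈p-y u∈p u≢x) (x∈p∧x≢y⇒x∈p-y v∈q v≢x)

respects-extendLast : ∀ (r : Fin n → ℕ) x P → Respects r (removeLast x P) → Respects (extendLast r x) P
respects-extendLast r x (just (X , Y , Z)) resp with canBeLast? x (X , Y , Z)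
respects-extendLast r x (just (X , Y , Z)) (X≺Y , Y≺Z , X≺Z) | yes (Y-last , X-last) =
    precedes-extendLast r x X≺Y (λ x∈X → m+n≡0⇒m≡0 ∣ Y ∣ (X-last x∈X))
  , precedes-extendLast r x Y≺Z Y-last
  , precedes-extendLast r x X≺Z (λ x∈X → m+n≡0⇒n≡0 ∣ Y ∣ (X-last x∈X))

Exclusive : (Fin m → Maybe (Pattern n)) → Set
Exclusive {n = n} F = ∀ (r : Fin n → ℕ) i j → Respects r (F i) → Respects r (F j) → i ≡ j

exclusive-removeLast : ∀ (F : Fin m → Maybe (Pattern n)) x → Exclusive F → Exclusive (λ i → removeLast x (F i))
exclusive-removeLast F x exclusive r i j resp-i resp-j =
  exclusive (extendLast r x) i j (respects-extendLast r x (F i) resp-i) (respects-extendLast r x (F j) resp-j)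

orderings-nothing : ∀ k (S : Subset n) → orderings k S nothing ≡ 0
orderings-nothing zero S = refl
orderings-nothing (suc k) S = ∑∈-zero S (λ _ → orderings-nothing k _)

orderings-zero≤1 : ∀ (S : Subset n) P → orderings 0 S P ≤ 1
orderings-zero≤1 S nothing = z≤n
orderings-zero≤1 S (just P) with size P ≟ 0
... | yes _ = ≤-refl
... | no _ = z≤n

orderings-zero-respects : ∀ (S : Subset n) P → 1 ≤ orderings 0 S P → Respects (λ _ → 0) P
orderings-zero-respects S nothing ()
orderings-zero-respects S (just (X , Y , Z)) 1≤orderings with size (X , Y , Z) ≟ 0
... | yes size≡0 = (λ u∈X _ → contradiction u∈X (∣p∣≡0⇒x∉p ∣X∣≡0))
                 , (λ u∈Y _ → contradiction u∈Y (∣p∣≡0⇒x∉p ∣Y∣≡0))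
                 , (λ u∈X _ → contradiction u∈X (∣p∣≡0⇒x∉p ∣X∣≡0))
  where
  ∣X∣≡0 : ∣ X ∣ ≡ 0
  ∣X∣≡0 = m+n≡0⇒m≡0 ∣ X ∣ size≡0
  ∣Y∣≡0 : ∣ Y ∣ ≡ 0
  ∣Y∣≡0 = m+n≡0⇒m≡0 ∣ Y ∣ (m+n≡0⇒n≡0 ∣ X ∣ size≡0)
orderings-zero-respects S (just (X , Y , Z)) () | no _

-- the orderings of S respecting the members of an exclusive family are
-- pairwise distinct, so there are at most k! of them in total
orderings-exclusive : ∀ k (S : Subset n) → ∣ S ∣ ≡ k → (F : Fin m → Maybe (Pattern n)) →
  Exclusive F → sum (λ i → orderings k S (F i)) ≤ k !
orderings-exclusive zero S _ F exclusive =
  sum≤1 _ (λ i → orderings-zero≤1 S (F i))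
    (λ i j 1≤i 1≤j → exclusive _ i j (orderings-zero-respects S (F i) 1≤i) (orderings-zero-respects S (F j) 1≤j))
orderings-exclusive (suc k) S ∣S∣≡1+k F exclusive = begin
  sum (λ i → ∑∈ S (λ x → later x i))                ≡⟨ ∑-comm (λ i x → 𝟙 S x * later x i) ⟩
  sum (λ x → sum (λ i → 𝟙 S x * later x i))         ≡⟨ sum-cong-≋ (λ x → *-distribˡ-sum (𝟙 S x) (later x)) ⟨
  ∑∈ S (λ x → sum (later x))                        ≤⟨ ∑∈-mono S restricted ⟩
  ∑∈ S (λ _ → k !)                                  ≡⟨ ∑∈-const S (k !) (λ _ → refl) ⟩
  ∣ S ∣ * k !                                       ≡⟨ cong (_* k !) ∣S∣≡1+k ⟩
  suc k ! ∎
  where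
  open ≤-Reasoning
  later : Fin _ → Fin _ → ℕ
  later x i = orderings k (S - x) (removeLast x (F i))
  restricted : ∀ {x} → x ∈ S → sum (later x) ≤ k !
  restricted {x} x∈S = orderings-exclusive k (S - x) (suc-injective (trans (∣p-x∣+1≡∣p∣ S x∈S) ∣S∣≡1+k))
    (λ i → removeLast x (F i)) (exclusive-removeLast F x exclusive)

-- Counting the orderings that respect a pattern

removeLast-yes : ∀ x (P : Pattern n) → CanBeLast x P → removeLast x (just P) ≡ just (P ⊖ x)
removeLast-yes x P can with canBeLast? x P
... | yes _ = refl
... | no cannot = contradiction can cannot

removeLast-no : ∀ x (P : Pattern n) → ¬ CanBeLast x P → removeLast x (just P) ≡ nothing
removeLast-no x P cannot with canBeLast? x P
... | yes can = contradiction can cannot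
... | no _ = refl

Disjoint : Subset n → Subset n → Set
Disjoint p q = ∀ {x} → x ∈ p → x ∉ q

Within : Subset n → Pattern n → Set
Within S (X , Y , Z) = (X ⊆ S × Y ⊆ S × Z ⊆ S) × (Disjoint X Y × Disjoint Y Z × Disjoint X Z)

within-⊖ : ∀ (S : Subset n) P x → Within S P → Within (S - x) (P ⊖ x)
within-⊖ S (X , Y , Z) x ((X⊆S , Y⊆S , Z⊆S) , (X∩Y , Y∩Z , X∩Z)) =
  (p⊆q⇒p-x⊆q-x X⊆S , p⊆q⇒p-x⊆q-x Y⊆S , p⊆q⇒p-x⊆q-x Z⊆S) , (shrink X Y X∩Y , shrink Y Z Y∩Z , shrink X Z X∩Z)
  where
  shrink : ∀ p q → Disjoint p q → Disjoint (p - x) (q - x)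
  shrink p q p∩q y∈p-x y∈q-x = p∩q (p─q⊆p p ⁅ x ⁆ y∈p-x) (p─q⊆p q ⁅ x ⁆ y∈q-x)

free : Subset n → Pattern n → Subset n
free S (X , Y , Z) = S ─ (X ∪ Y ∪ Z)

∉∪∪ : ∀ (X Y Z : Subset n) → x ∉ X → x ∉ Y → x ∉ Z → x ∉ X ∪ Y ∪ Z
∉∪∪ X Y Z x∉X x∉Y x∉Z x∈X∪Y∪Z with x∈p∪q⁻ X (Y ∪ Z) x∈X∪Y∪Z
... | inj₁ x∈X = x∉X x∈X
... | inj₂ x∈Y∪Z = [ x∉Y , x∉Z ]′ (x∈p∪q⁻ Y Z x∈Y∪Z)

∉free : ∀ (S : Subset n) (P : Pattern n) → let (X , Y , Z) = P in x ∈ X ∪ Y ∪ Z → x ∉ free S P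
∉free S (X , Y , Z) x∈blocks x∈free = x∈p─q⇒x∉q S (X ∪ Y ∪ Z) x∈free x∈blocks

𝟙-partition : ∀ (S : Subset n) P → Within S P → ∀ x →
  let (X , Y , Z) = P in 𝟙 S x ≡ 𝟙 (free S P) x + (𝟙 X x + (𝟙 Y x + 𝟙 Z x))
𝟙-partition S P@(X , Y , Z) ((X⊆S , Y⊆S , Z⊆S) , (X∩Y , Y∩Z , X∩Z)) x with x ∈? X
... | yes x∈X rewrite 𝟙-∈ (X⊆S x∈X) | 𝟙-∉ (∉free S P (x∈p∪q⁺ (inj₁ x∈X)))
                    | 𝟙-∉ (X∩Y x∈X) | 𝟙-∉ (X∩Z x∈X) = refl
... | no x∉X with x ∈? Y
...   | yes x∈Y rewrite 𝟙-∈ (Y⊆S x∈Y) | 𝟙-∉ (∉free S P (x∈p∪q⁺ (inj₂ (x∈p∪q⁺ (inj₁ x∈Y)))))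
                      | 𝟙-∉ (Y∩Z x∈Y) = refl
...   | no x∉Y with x ∈? Z
...     | yes x∈Z rewrite 𝟙-∈ (Z⊆S x∈Z) | 𝟙-∉ (∉free S P (x∈p∪q⁺ (inj₂ (x∈p∪q⁺ (inj₂ x∈Z))))) = refl
...     | no x∉Z with x ∈? S
...       | yes x∈S rewrite 𝟙-∈ (x∈p∧x∉q⇒x∈p─q x∈S (∉∪∪ X Y Z x∉X x∉Y x∉Z)) = refl
...       | no x∉S rewrite 𝟙-∉ (x∉S ∘ p─q⊆p S (X ∪ Y ∪ Z)) = refl

∑∈-partition : ∀ (S : Subset n) P → Within S P → ∀ f →
  let (X , Y , Z) = P in ∑∈ S f ≡ ∑∈ (free S P) f + (∑∈ X f + (∑∈ Y f + ∑∈ Z f))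
∑∈-partition S P@(X , Y , Z) within f = begin
  ∑∈ S f
    ≡⟨ sum-cong-≋ (λ x → trans (cong (_* f x) (𝟙-partition S P within x)) (distribute (𝟙 R x) (𝟙 X x) (𝟙 Y x) (𝟙 Z x) (f x))) ⟩
  sum (λ x → 𝟙 R x * f x + (𝟙 X x * f x + (𝟙 Y x * f x + 𝟙 Z x * f x)))
    ≡⟨ ∑-distrib-+ (λ x → 𝟙 R x * f x) _ ⟩
  ∑∈ R f + sum (λ x → 𝟙 X x * f x + (𝟙 Y x * f x + 𝟙 Z x * f x))
    ≡⟨ cong (∑∈ R f +_) (∑-distrib-+ (λ x → 𝟙 X x * f x) _) ⟩
  ∑∈ R f + (∑∈ X f + sum (λ x → 𝟙 Y x * f x + 𝟙 Z x * f x))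
    ≡⟨ cong (λ t → ∑∈ R f + (∑∈ X f + t)) (∑-distrib-+ (λ x → 𝟙 Y x * f x) _) ⟩
  ∑∈ R f + (∑∈ X f + (∑∈ Y f + ∑∈ Z f)) ∎
  where
  open ≡-Reasoning
  R = free S P
  distribute : ∀ r a b c v → (r + (a + (b + c))) * v ≡ r * v + (a * v + (b * v + c * v))
  distribute = solve-∀

∑∈-one : ∀ (p : Subset n) → ∑∈ p (λ _ → 1) ≡ ∣ p ∣
∑∈-one p = trans (∑∈-const p 1 (λ _ → refl)) (*-identityʳ ∣ p ∣)

∣S∣≡∣free∣+size : ∀ (S : Subset n) P → Within S P → ∣ S ∣ ≡ ∣ free S P ∣ + size P
∣S∣≡∣free∣+size S P@(X , Y , Z) within = begin
  ∣ S ∣                                  ≡⟨ ∑∈-one S ⟨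
  ∑∈ S one                               ≡⟨ ∑∈-partition S P within one ⟩
  ∑∈ (free S P) one + (∑∈ X one + (∑∈ Y one + ∑∈ Z one))
    ≡⟨ cong₂ _+_ (∑∈-one (free S P)) (cong₂ _+_ (∑∈-one X) (cong₂ _+_ (∑∈-one Y) (∑∈-one Z))) ⟩
  ∣ free S P ∣ + size P                  ∎
  where
  open ≡-Reasoning
  one : Fin _ → ℕ
  one _ = 1

shrink-first : ∀ {a a′ c c′ b b′} → suc a′ ≡ a → c′ ≡ c → b′ ≡ b → suc (a′ + (c′ + b′)) ≡ a + (c + b)
shrink-first refl refl refl = refl

shrink-middle : ∀ {a a′ c c′ b b′} → a′ ≡ a → suc c′ ≡ c → b′ ≡ b → suc (a′ + (c′ + b′)) ≡ a + (c + b)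
shrink-middle {a} {c′ = c′} {b = b} refl refl refl = sym (+-suc a (c′ + b))

shrink-last : ∀ {a a′ c c′ b b′} → a′ ≡ a → c′ ≡ c → suc b′ ≡ b → suc (a′ + (c′ + b′)) ≡ a + (c + b)
shrink-last {a} {c = c} {b′ = b′} refl refl refl = sym (trans (cong (a +_) (+-suc c b′)) (+-suc a (c + b′)))

-- One step of the count: the orderings of S are sorted by their last element.
module CountingStep {n} (k : ℕ) (S X Y Z : Subset n)
  (X⊆S : X ⊆ S) (Y⊆S : Y ⊆ S) (Z⊆S : Z ⊆ S)
  (X∩Y : Disjoint X Y) (Y∩Z : Disjoint Y Z) (X∩Z : Disjoint X Z)
  (∣S∣≡1+k : ∣ S ∣ ≡ suc k)
  (count : ∀ (S′ : Subset n) P′ → Within S′ P′ → ∣ S′ ∣ ≡ k →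
           orderings k S′ (just P′) * size P′ ! ≡ k ! * weight P′) where

  P : Pattern n
  P = X , Y , Z

  within : Within S P
  within = (X⊆S , Y⊆S , Z⊆S) , (X∩Y , Y∩Z , X∩Z)

  W : Fin n → ℕ
  W x = orderings k (S - x) (removeLast x (just P)) * size P !

  ordered-rest : ∀ {x} → x ∈ S → CanBeLast x P →
    orderings k (S - x) (removeLast x (just P)) * size (P ⊖ x) ! ≡ k ! * weight (P ⊖ x)
  ordered-rest {x} x∈S can rewrite removeLast-yes x P can =
    count (S - x) (P ⊖ x) (within-⊖ S P x within) (suc-injective (trans (∣p-x∣+1≡∣p∣ S x∈S) ∣S∣≡1+k))

  W-dead : ∀ {x} → ¬ CanBeLast x P → W x ≡ 0
  W-dead {x} cannot rewrite removeLast-no x P cannot | orderings-nothing k (S - x) = refl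

  -- a free element leaves the pattern unchanged
  W-free : ∀ {x} → x ∈ free S P → W x ≡ k ! * weight P
  W-free {x} x∈free = subst (λ Q → orderings k (S - x) (removeLast x (just P)) * size Q ! ≡ k ! * weight Q)
    unchanged (ordered-rest x∈S ((λ x∈Y → contradiction x∈Y x∉Y) , (λ x∈X → contradiction x∈X x∉X)))
    where
    x∈S : x ∈ S
    x∈S = p─q⊆p S (X ∪ Y ∪ Z) x∈free
    x∉X : x ∉ X
    x∉X x∈X = ∉free S P (x∈p∪q⁺ (inj₁ x∈X)) x∈free
    x∉Y : x ∉ Y
    x∉Y x∈Y = ∉free S P (x∈p∪q⁺ (inj₂ (x∈p∪q⁺ (inj₁ x∈Y)))) x∈free
    x∉Z : x ∉ Z
    x∉Z x∈Z = ∉free S P (x∈p∪q⁺ (inj₂ (x∈p∪q⁺ (inj₂ x∈Z)))) x∈free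
    unchanged : P ⊖ x ≡ P
    unchanged = cong₂ _,_ (p-x≡p X x∉X) (cong₂ _,_ (p-x≡p Y x∉Y) (p-x≡p Z x∉Z))

  W-last : ∀ {x} → x ∈ S → CanBeLast x P → suc (size (P ⊖ x)) ≡ size P →
    W x ≡ size P * (k ! * weight (P ⊖ x))
  W-last {x} x∈S can size-drop = begin
    V * size P !                    ≡⟨ cong (λ s → V * s !) size-drop ⟨
    V * (suc s′ * s′ !)             ≡⟨ swap V (suc s′) (s′ !) ⟩
    suc s′ * (V * s′ !)             ≡⟨ cong (suc s′ *_) (ordered-rest x∈S can) ⟩
    suc s′ * (k ! * weight (P ⊖ x)) ≡⟨ cong (_* (k ! * weight (P ⊖ x))) size-drop ⟩
    size P * (k ! * weight (P ⊖ x)) ∎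
    where
    open ≡-Reasoning
    V : ℕ
    V = orderings k (S - x) (removeLast x (just P))
    s′ : ℕ
    s′ = size (P ⊖ x)
    swap : ∀ a b c → a * (b * c) ≡ b * (a * c)
    swap = solve-∀

  last-block : ∀ (B : Subset n) {ℓ w′} → B ⊆ S → ∣ B ∣ ≡ suc ℓ →
    (∀ {x} → x ∈ B → CanBeLast x P × suc (size (P ⊖ x)) ≡ size P × weight (P ⊖ x) ≡ w′) →
    suc ℓ * w′ ≡ weight P → ∑∈ B W ≡ size P * (k ! * weight P)
  last-block B {ℓ} {w′} B⊆S ∣B∣≡1+ℓ removal split = begin
    ∑∈ B W                         ≡⟨ ∑∈-const B _ constant ⟩
    ∣ B ∣ * (size P * (k ! * w′))  ≡⟨ cong (_* (size P * (k ! * w′))) ∣B∣≡1+ℓ ⟩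
    suc ℓ * (size P * (k ! * w′))  ≡⟨ rearrange (suc ℓ) (size P) (k !) w′ ⟩
    size P * (k ! * (suc ℓ * w′))  ≡⟨ cong (λ v → size P * (k ! * v)) split ⟩
    size P * (k ! * weight P)      ∎
    where
    open ≡-Reasoning
    constant : ∀ {x} → x ∈ B → W x ≡ size P * (k ! * w′)
    constant x∈B with removal x∈B
    ... | can , size-drop , weight≡ = trans (W-last (B⊆S x∈B) can size-drop) (cong (λ v → size P * (k ! * v)) weight≡)
    rearrange : ∀ l s f w → l * (s * (f * w)) ≡ s * (f * (l * w))
    rearrange = solve-∀

  empty-block : ∀ (B : Subset n) → ∣ B ∣ ≡ 0 → ∑∈ B W ≡ 0
  empty-block B ∣B∣≡0 = ∑∈-zero B (λ x∈B → contradiction x∈B (∣p∣≡0⇒x∉p ∣B∣≡0))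

  dead-block : ∀ (B : Subset n) → (∀ {x} → x ∈ B → ¬ CanBeLast x P) → ∑∈ B W ≡ 0
  dead-block B dead = ∑∈-zero B (λ x∈B → W-dead (dead x∈B))

  -- the total contribution of the blocks; only the last non-empty block counts
  Blocks : Set
  Blocks = ∑∈ X W + (∑∈ Y W + ∑∈ Z W) ≡ size P * (k ! * weight P)

  last-in-Z : ∀ {ℓ} → ∣ Z ∣ ≡ suc ℓ → Blocks
  last-in-Z {ℓ} ∣Z∣≡1+ℓ =
    cong₂ _+_ (dead-block X (λ x∈X (_ , X-last) → Z≢0 (m+n≡0⇒n≡0 ∣ Y ∣ (X-last x∈X))))
      (cong₂ _+_ (dead-block Y (λ x∈Y (Y-last , _) → Z≢0 (Y-last x∈Y)))
        (last-block Z Z⊆S ∣Z∣≡1+ℓ removal split))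
    where
    Z≢0 : ∣ Z ∣ ≢ 0
    Z≢0 ∣Z∣≡0 = 1+n≢0 (trans (sym ∣Z∣≡1+ℓ) ∣Z∣≡0)
    removal : ∀ {x} → x ∈ Z → CanBeLast x P × suc (size (P ⊖ x)) ≡ size P × weight (P ⊖ x) ≡ ∣ X ∣ ! * (∣ Y ∣ ! * ℓ !)
    removal {x} x∈Z =
      ((λ x∈Y → contradiction x∈Z (Y∩Z x∈Y)) , (λ x∈X → contradiction x∈Z (X∩Z x∈X))) ,
      shrink-last X-same Y-same (∣p-x∣+1≡∣p∣ Z x∈Z) ,
      cong₂ (λ a v → a ! * v) X-same (cong₂ (λ c l → c ! * l !) Y-same Z-shrunk)
      where
      X-same : ∣ X - x ∣ ≡ ∣ X ∣
      X-same = ∣p-x∣≡∣p∣ X (λ x∈X → X∩Z x∈X x∈Z)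
      Y-same : ∣ Y - x ∣ ≡ ∣ Y ∣
      Y-same = ∣p-x∣≡∣p∣ Y (λ x∈Y → Y∩Z x∈Y x∈Z)
      Z-shrunk : ∣ Z - x ∣ ≡ ℓ
      Z-shrunk = suc-injective (trans (∣p-x∣+1≡∣p∣ Z x∈Z) ∣Z∣≡1+ℓ)
    split : suc ℓ * (∣ X ∣ ! * (∣ Y ∣ ! * ℓ !)) ≡ weight P
    split = trans (rearrange (suc ℓ) (∣ X ∣ !) (∣ Y ∣ !) (ℓ !)) (cong (λ z → ∣ X ∣ ! * (∣ Y ∣ ! * z !)) (sym ∣Z∣≡1+ℓ))
      where
      rearrange : ∀ l a c f → l * (a * (c * f)) ≡ a * (c * (l * f))
      rearrange = solve-∀

  last-in-Y : ∀ {ℓ} → ∣ Z ∣ ≡ 0 → ∣ Y ∣ ≡ suc ℓ → Blocks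
  last-in-Y {ℓ} ∣Z∣≡0 ∣Y∣≡1+ℓ =
    cong₂ _+_ (dead-block X (λ x∈X (_ , X-last) → Y≢0 (m+n≡0⇒m≡0 ∣ Y ∣ (X-last x∈X))))
      (trans (cong₂ _+_ (last-block Y Y⊆S ∣Y∣≡1+ℓ removal split) (empty-block Z ∣Z∣≡0)) (+-identityʳ _))
    where
    Y≢0 : ∣ Y ∣ ≢ 0
    Y≢0 ∣Y∣≡0 = 1+n≢0 (trans (sym ∣Y∣≡1+ℓ) ∣Y∣≡0)
    removal : ∀ {x} → x ∈ Y → CanBeLast x P × suc (size (P ⊖ x)) ≡ size P × weight (P ⊖ x) ≡ ∣ X ∣ ! * (ℓ ! * ∣ Z ∣ !)
    removal {x} x∈Y =
      ((λ _ → ∣Z∣≡0) , (λ x∈X → contradiction x∈Y (X∩Y x∈X))) ,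
      shrink-middle X-same (∣p-x∣+1≡∣p∣ Y x∈Y) Z-same ,
      cong₂ (λ a v → a ! * v) X-same (cong₂ (λ l b → l ! * b !) Y-shrunk Z-same)
      where
      X-same : ∣ X - x ∣ ≡ ∣ X ∣
      X-same = ∣p-x∣≡∣p∣ X (λ x∈X → X∩Y x∈X x∈Y)
      Z-same : ∣ Z - x ∣ ≡ ∣ Z ∣
      Z-same = ∣p-x∣≡∣p∣ Z (Y∩Z x∈Y)
      Y-shrunk : ∣ Y - x ∣ ≡ ℓ
      Y-shrunk = suc-injective (trans (∣p-x∣+1≡∣p∣ Y x∈Y) ∣Y∣≡1+ℓ)
    split : suc ℓ * (∣ X ∣ ! * (ℓ ! * ∣ Z ∣ !)) ≡ weight P
    split = trans (rearrange (suc ℓ) (∣ X ∣ !) (ℓ !) (∣ Z ∣ !)) (cong (λ y → ∣ X ∣ ! * (y ! * ∣ Z ∣ !)) (sym ∣Y∣≡1+ℓ))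
      where
      rearrange : ∀ l a f b → l * (a * (f * b)) ≡ a * (l * f * b)
      rearrange = solve-∀

  last-in-X : ∀ {ℓ} → ∣ Z ∣ ≡ 0 → ∣ Y ∣ ≡ 0 → ∣ X ∣ ≡ suc ℓ → Blocks
  last-in-X {ℓ} ∣Z∣≡0 ∣Y∣≡0 ∣X∣≡1+ℓ =
    trans (cong₂ _+_ (last-block X X⊆S ∣X∣≡1+ℓ removal split) (cong₂ _+_ (empty-block Y ∣Y∣≡0) (empty-block Z ∣Z∣≡0)))
      (+-identityʳ _)
    where
    removal : ∀ {x} → x ∈ X → CanBeLast x P × suc (size (P ⊖ x)) ≡ size P × weight (P ⊖ x) ≡ ℓ ! * (∣ Y ∣ ! * ∣ Z ∣ !)
    removal {x} x∈X =
      ((λ _ → ∣Z∣≡0) , (λ _ → cong₂ _+_ ∣Y∣≡0 ∣Z∣≡0)) ,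
      shrink-first (∣p-x∣+1≡∣p∣ X x∈X) Y-same Z-same ,
      cong₂ (λ l v → l ! * v) X-shrunk (cong₂ (λ c b → c ! * b !) Y-same Z-same)
      where
      Y-same : ∣ Y - x ∣ ≡ ∣ Y ∣
      Y-same = ∣p-x∣≡∣p∣ Y (X∩Y x∈X)
      Z-same : ∣ Z - x ∣ ≡ ∣ Z ∣
      Z-same = ∣p-x∣≡∣p∣ Z (X∩Z x∈X)
      X-shrunk : ∣ X - x ∣ ≡ ℓ
      X-shrunk = suc-injective (trans (∣p-x∣+1≡∣p∣ X x∈X) ∣X∣≡1+ℓ)
    split : suc ℓ * (ℓ ! * (∣ Y ∣ ! * ∣ Z ∣ !)) ≡ weight P
    split = trans (sym (*-assoc (suc ℓ) (ℓ !) _)) (cong (λ x → x ! * (∣ Y ∣ ! * ∣ Z ∣ !)) (sym ∣X∣≡1+ℓ))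

  all-empty : ∣ Z ∣ ≡ 0 → ∣ Y ∣ ≡ 0 → ∣ X ∣ ≡ 0 → Blocks
  all-empty ∣Z∣≡0 ∣Y∣≡0 ∣X∣≡0 =
    trans (cong₂ _+_ (empty-block X ∣X∣≡0) (cong₂ _+_ (empty-block Y ∣Y∣≡0) (empty-block Z ∣Z∣≡0)))
      (cong (_* (k ! * weight P)) (sym (cong₂ _+_ ∣X∣≡0 (cong₂ _+_ ∣Y∣≡0 ∣Z∣≡0))))

  blocks : Blocks
  blocks with size-cases Z | size-cases Y | size-cases X
  ... | inj₂ (_ , ∣Z∣≡1+ℓ) | _ | _ = last-in-Z ∣Z∣≡1+ℓ
  ... | inj₁ ∣Z∣≡0 | inj₂ (_ , ∣Y∣≡1+ℓ) | _ = last-in-Y ∣Z∣≡0 ∣Y∣≡1+ℓ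
  ... | inj₁ ∣Z∣≡0 | inj₁ ∣Y∣≡0 | inj₂ (_ , ∣X∣≡1+ℓ) = last-in-X ∣Z∣≡0 ∣Y∣≡0 ∣X∣≡1+ℓ
  ... | inj₁ ∣Z∣≡0 | inj₁ ∣Y∣≡0 | inj₁ ∣X∣≡0 = all-empty ∣Z∣≡0 ∣Y∣≡0 ∣X∣≡0

  -- free elements contribute one full count each, the blocks size P of them
  step : orderings (suc k) S (just P) * size P ! ≡ suc k ! * weight P
  step = begin
    ∑∈ S (λ x → orderings k (S - x) (removeLast x (just P))) * size P !
      ≡⟨ ∑∈-*ʳ S _ (size P !) ⟩
    ∑∈ S W
      ≡⟨ ∑∈-partition S P within W ⟩
    ∑∈ R W + (∑∈ X W + (∑∈ Y W + ∑∈ Z W))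
      ≡⟨ cong₂ _+_ (∑∈-const R _ W-free) blocks ⟩
    ∣ R ∣ * K + size P * K
      ≡⟨ *-distribʳ-+ K ∣ R ∣ (size P) ⟨
    (∣ R ∣ + size P) * K
      ≡⟨ cong (_* K) (trans (sym (∣S∣≡∣free∣+size S P within)) ∣S∣≡1+k) ⟩
    suc k * (k ! * weight P)
      ≡⟨ *-assoc (suc k) (k !) (weight P) ⟨
    suc k ! * weight P ∎
    where
    open ≡-Reasoning
    R : Subset n
    R = free S P
    K : ℕ
    K = k ! * weight P

empty-weight : ∀ a c b → a + (c + b) ≡ 0 → (a + (c + b)) ! ≡ a ! * (c ! * b !)
empty-weight zero zero zero _ = refl

orderings-count : ∀ k (S : Subset n) P → Within S P → ∣ S ∣ ≡ k →
  orderings k S (just P) * size P ! ≡ k ! * weight P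
orderings-count zero S P@(X , Y , Z) within ∣S∣≡0 with size P ≟ 0
... | yes size≡0 = cong (1 *_) (empty-weight (∣ X ∣) (∣ Y ∣) (∣ Z ∣) size≡0)
... | no size≢0 = contradiction (m+n≡0⇒n≡0 ∣ free S P ∣ (trans (sym (∣S∣≡∣free∣+size S P within)) ∣S∣≡0)) size≢0
orderings-count (suc k) S (X , Y , Z) ((X⊆S , Y⊆S , Z⊆S) , (X∩Y , Y∩Z , X∩Z)) ∣S∣≡1+k =
  CountingStep.step k S X Y Z X⊆S Y⊆S Z⊆S X∩Y Y∩Z X∩Z ∣S∣≡1+k (orderings-count k)

-- The patterns of the pairs (A_i , B_i)

pairPattern : Subset n → Subset n → Pattern n
pairPattern A B = A ─ B , A ∩ B , B ─ A

module RespectsPair {n} (r : Fin n → ℕ) (A B : Subset n) (resp : Respects r (just (pairPattern A B))) where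

  A≺B─A : ∀ {u v} → u ∈ A → v ∈ B → v ∉ A → r u < r v
  A≺B─A {u} u∈A v∈B v∉A with u ∈? B
  ... | yes u∈B = proj₁ (proj₂ resp) (x∈p∩q⁺ (u∈A , u∈B)) (x∈p∧x∉q⇒x∈p─q v∈B v∉A)
  ... | no u∉B = proj₂ (proj₂ resp) (x∈p∧x∉q⇒x∈p─q u∈A u∉B) (x∈p∧x∉q⇒x∈p─q v∈B v∉A)

  A─B≺A∩B : ∀ {u v} → u ∈ A → u ∉ B → v ∈ A ∩ B → r u < r v
  A─B≺A∩B u∈A u∉B v∈A∩B = proj₁ resp (x∈p∧x∉q⇒x∈p─q u∈A u∉B) v∈A∩B

Forbidden : Subset n → Subset n → Subset n → Subset n → Set
Forbidden A₁ B₁ A₂ B₂ = A₁ ∩ B₁ ≡ A₂ ∩ B₂ × A₁ ∩ B₂ ≡ A₁ ∩ B₁ × A₁ ∩ B₁ ≡ A₂ ∩ B₁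

∩≡⇒⊆ : ∀ (A B : Subset n) {C} → A ∩ B ≡ C → C ⊆ A
∩≡⇒⊆ A B refl x∈A∩B = proj₁ (x∈p∩q⁻ A B x∈A∩B)

squeeze : ∀ (A₁ A₂ B₂ : Subset n) → A₁ ∩ B₂ ⊆ A₂ → ∣ A₂ ∩ B₂ ∣ ≤ ∣ A₁ ∩ B₂ ∣ → A₁ ∩ B₂ ≡ A₂ ∩ B₂
squeeze A₁ A₂ B₂ D⊆A₂ = ⊆-by-size (λ x∈D → x∈p∩q⁺ (D⊆A₂ x∈D , proj₂ (x∈p∩q⁻ A₁ B₂ x∈D)))

module TwoPairs {n} {t : ℕ} (1≤t : 1 ≤ t) (A₁ B₁ A₂ B₂ : Subset n)
  (small₁ : ∣ A₁ ∩ B₁ ∣ ≤ t) (small₂ : ∣ A₂ ∩ B₂ ∣ ≤ t)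
  (large₁₂ : t ≤ ∣ A₁ ∩ B₂ ∣) (large₂₁ : t ≤ ∣ A₂ ∩ B₁ ∣)
  (r : Fin n → ℕ) (resp₁ : Respects r (just (pairPattern A₁ B₁))) (resp₂ : Respects r (just (pairPattern A₂ B₂))) where

  open RespectsPair r A₁ B₁ resp₁ using () renaming (A≺B─A to A₁≺B₁─A₁; A─B≺A∩B to A₁─B₁≺C₁)
  open RespectsPair r A₂ B₂ resp₂ using () renaming (A─B≺A∩B to A₂─B₂≺C₂)

  -- once A₁ ∩ B₂ = A₂ ∩ B₂ is known, A₂ ∩ B₁ lies in A₁: an element v of A₂ ∩ B₁
  -- outside A₁ would come after the elements of A₂ ∩ B₂ ⊆ A₁ and, lying
  -- in A₂ ─ B₂, also before them
  propagate : A₁ ∩ B₂ ≡ A₂ ∩ B₂ → A₂ ∩ B₁ ⊆ A₁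
  propagate D₁₂≡C₂ v∈D₂₁ = inside-A₁ (x∈p∩q⁻ A₂ B₁ v∈D₂₁)
    where
    C₂⊆A₁ : A₂ ∩ B₂ ⊆ A₁
    C₂⊆A₁ = ∩≡⇒⊆ A₁ B₂ D₁₂≡C₂
    C₂-nonempty : Nonempty (A₂ ∩ B₂)
    C₂-nonempty = 0<∣p∣⇒Nonempty (≤-trans 1≤t (subst (λ C → t ≤ ∣ C ∣) D₁₂≡C₂ large₁₂))
    inside-A₁ : ∀ {v} → v ∈ A₂ × v ∈ B₁ → v ∈ A₁
    inside-A₁ {v} (v∈A₂ , v∈B₁) with v ∈? A₁ | v ∈? B₂ | C₂-nonempty
    ... | yes v∈A₁ | _ | _ = v∈A₁
    ... | no v∉A₁ | yes v∈B₂ | _ = contradiction (C₂⊆A₁ (x∈p∩q⁺ (v∈A₂ , v∈B₂))) v∉A₁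
    ... | no v∉A₁ | no v∉B₂ | (y , y∈C₂) =
      contradiction (A₂─B₂≺C₂ v∈A₂ v∉B₂ y∈C₂) (<⇒≯ (A₁≺B₁─A₁ (C₂⊆A₁ y∈C₂) v∈B₁ v∉A₁))

  -- with both cross intersections equal to the cores, one core contains the other:
  -- otherwise some z ∈ A₁ ∩ B₁ ─ B₂ and y ∈ A₂ ∩ B₂ ─ B₁ would each precede the other
  nested-cores : A₁ ∩ B₂ ≡ A₂ ∩ B₂ → A₂ ∩ B₁ ≡ A₁ ∩ B₁ → A₁ ∩ B₁ ⊆ A₂ ∩ B₂ ⊎ A₂ ∩ B₂ ⊆ A₁ ∩ B₁
  nested-cores D₁₂≡C₂ D₂₁≡C₁ with Nonempty─⊎⊆ (A₁ ∩ B₁) B₂ | Nonempty─⊎⊆ (A₂ ∩ B₂) B₁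
  ... | inj₂ C₁⊆B₂ | _ = inj₁ (λ z∈C₁ → x∈p∩q⁺ (∩≡⇒⊆ A₂ B₁ D₂₁≡C₁ z∈C₁ , C₁⊆B₂ z∈C₁))
  ... | _ | inj₂ C₂⊆B₁ = inj₂ (λ y∈C₂ → x∈p∩q⁺ (∩≡⇒⊆ A₁ B₂ D₁₂≡C₂ y∈C₂ , C₂⊆B₁ y∈C₂))
  ... | inj₁ (z , z∈C₁─B₂) | inj₁ (y , y∈C₂─B₁) =
    contradiction (A₂─B₂≺C₂ (C₁⊆A₂ z∈C₁) (x∈p─q⇒x∉q _ B₂ z∈C₁─B₂) y∈C₂)
                  (<⇒≯ (A₁─B₁≺C₁ (C₂⊆A₁ y∈C₂) (x∈p─q⇒x∉q _ B₁ y∈C₂─B₁) z∈C₁))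
    where
    z∈C₁ : z ∈ A₁ ∩ B₁
    z∈C₁ = p─q⊆p (A₁ ∩ B₁) B₂ z∈C₁─B₂
    y∈C₂ : y ∈ A₂ ∩ B₂
    y∈C₂ = p─q⊆p (A₂ ∩ B₂) B₁ y∈C₂─B₁
    C₁⊆A₂ : A₁ ∩ B₁ ⊆ A₂
    C₁⊆A₂ = ∩≡⇒⊆ A₂ B₁ D₂₁≡C₁
    C₂⊆A₁ : A₂ ∩ B₂ ⊆ A₁
    C₂⊆A₁ = ∩≡⇒⊆ A₁ B₂ D₁₂≡C₂

  forbidden : A₁ ∩ B₂ ⊆ A₂ → Forbidden A₁ B₁ A₂ B₂
  forbidden D₁₂⊆A₂ = C₁≡C₂ , trans D₁₂≡C₂ (sym C₁≡C₂) , sym D₂₁≡C₁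
    where
    D₁₂≡C₂ : A₁ ∩ B₂ ≡ A₂ ∩ B₂
    D₁₂≡C₂ = squeeze A₁ A₂ B₂ D₁₂⊆A₂ (≤-trans small₂ large₁₂)
    D₂₁≡C₁ : A₂ ∩ B₁ ≡ A₁ ∩ B₁
    D₂₁≡C₁ = squeeze A₂ A₁ B₁ (propagate D₁₂≡C₂) (≤-trans small₁ large₂₁)
    C₁≡C₂ : A₁ ∩ B₁ ≡ A₂ ∩ B₂
    C₁≡C₂ with nested-cores D₁₂≡C₂ D₂₁≡C₁
    ... | inj₁ C₁⊆C₂ = ⊆-by-size C₁⊆C₂ (≤-trans small₂ (subst (λ C → t ≤ ∣ C ∣) D₂₁≡C₁ large₂₁))
    ... | inj₂ C₂⊆C₁ = sym (⊆-by-size C₂⊆C₁ (≤-trans small₁ (subst (λ C → t ≤ ∣ C ∣) D₁₂≡C₂ large₁₂)))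

-- two distinct pairs are never respected by a common ordering: either one of
-- them meets the other's forbidden configuration, or elements u ∈ A₁ ∩ B₂ ─ A₂
-- and v ∈ A₂ ∩ B₁ ─ A₁ would each precede the other
common-ordering⇒forbidden : ∀ {t} → 1 ≤ t → (A₁ B₁ A₂ B₂ : Subset n) →
  ∣ A₁ ∩ B₁ ∣ ≤ t → ∣ A₂ ∩ B₂ ∣ ≤ t → t ≤ ∣ A₁ ∩ B₂ ∣ → t ≤ ∣ A₂ ∩ B₁ ∣ →
  ∀ r → Respects r (just (pairPattern A₁ B₁)) → Respects r (just (pairPattern A₂ B₂)) →
  Forbidden A₁ B₁ A₂ B₂ ⊎ Forbidden A₂ B₂ A₁ B₁
common-ordering⇒forbidden 1≤t A₁ B₁ A₂ B₂ small₁ small₂ large₁₂ large₂₁ r resp₁ resp₂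
  with Nonempty─⊎⊆ (A₁ ∩ B₂) A₂ | Nonempty─⊎⊆ (A₂ ∩ B₁) A₁
... | inj₂ D₁₂⊆A₂ | _ = inj₁ (TwoPairs.forbidden 1≤t A₁ B₁ A₂ B₂ small₁ small₂ large₁₂ large₂₁ r resp₁ resp₂ D₁₂⊆A₂)
... | _ | inj₂ D₂₁⊆A₁ = inj₂ (TwoPairs.forbidden 1≤t A₂ B₂ A₁ B₁ small₂ small₁ large₂₁ large₁₂ r resp₂ resp₁ D₂₁⊆A₁)
... | inj₁ (u , u∈D₁₂─A₂) | inj₁ (v , v∈D₂₁─A₁) =
  contradiction (RespectsPair.A≺B─A r A₁ B₁ resp₁ u∈A₁ v∈B₁ (x∈p─q⇒x∉q _ A₁ v∈D₂₁─A₁))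
                (<⇒≯ (RespectsPair.A≺B─A r A₂ B₂ resp₂ v∈A₂ u∈B₂ (x∈p─q⇒x∉q _ A₂ u∈D₁₂─A₂)))
  where
  u∈D₁₂ : u ∈ A₁ ∩ B₂
  u∈D₁₂ = p─q⊆p _ A₂ u∈D₁₂─A₂
  v∈D₂₁ : v ∈ A₂ ∩ B₁
  v∈D₂₁ = p─q⊆p _ A₁ v∈D₂₁─A₁
  u∈A₁ : u ∈ A₁
  u∈A₁ = proj₁ (x∈p∩q⁻ A₁ B₂ u∈D₁₂)
  u∈B₂ : u ∈ B₂
  u∈B₂ = proj₂ (x∈p∩q⁻ A₁ B₂ u∈D₁₂)
  v∈A₂ : v ∈ A₂
  v∈A₂ = proj₁ (x∈p∩q⁻ A₂ B₁ v∈D₂₁)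
  v∈B₁ : v ∈ B₁
  v∈B₁ = proj₂ (x∈p∩q⁻ A₂ B₁ v∈D₂₁)

pairs-exclusive : ∀ {t} → 1 ≤ t → (A B : Fin m → Subset n) →
  (∀ i → ∣ A i ∩ B i ∣ ≤ t) →
  (∀ i j → i ≢ j → t ≤ ∣ A i ∩ B j ∣) →
  (∀ i j → i ≢ j → A i ∩ B i ≡ A j ∩ B j → ¬ ((A i ∩ B j ≡ A i ∩ B i) × (A i ∩ B i ≡ A j ∩ B i))) →
  Exclusive (λ i → just (pairPattern (A i) (B i)))
pairs-exclusive 1≤t A B small large not-forbidden r i j resp-i resp-j with i Fin.≟ j
... | yes i≡j = i≡j
... | no i≢j with common-ordering⇒forbidden 1≤t (A i) (B i) (A j) (B j)
                    (small i) (small j) (large i j i≢j) (large j i (i≢j ∘ sym)) r resp-i resp-j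
...   | inj₁ (C≡ , D≡ , D′≡) = contradiction (D≡ , D′≡) (not-forbidden i j i≢j C≡)
...   | inj₂ (C≡ , D≡ , D′≡) = contradiction (D≡ , D′≡) (not-forbidden j i (i≢j ∘ sym) C≡)

∣A∪B∣≡ : ∀ (A B : Subset n) → ∣ A ∪ B ∣ ≡ ∣ A ─ B ∣ + (∣ A ∩ B ∣ + ∣ B ─ A ∣)
∣A∪B∣≡ [] [] = refl
∣A∪B∣≡ (inside ∷ A) (inside ∷ B) = trans (cong suc (∣A∪B∣≡ A B)) (sym (+-suc ∣ A ─ B ∣ _))
∣A∪B∣≡ (inside ∷ A) (outside ∷ B) = cong suc (∣A∪B∣≡ A B)
∣A∪B∣≡ (outside ∷ A) (inside ∷ B) = trans (cong suc (∣A∪B∣≡ A B))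
  (sym (trans (cong (∣ A ─ B ∣ +_) (+-suc ∣ A ∩ B ∣ ∣ B ─ A ∣)) (+-suc ∣ A ─ B ∣ _)))
∣A∪B∣≡ (outside ∷ A) (outside ∷ B) = ∣A∪B∣≡ A B

∣B∣≡ : ∀ (A B : Subset n) → ∣ B ∣ ≡ ∣ A ∩ B ∣ + ∣ B ─ A ∣
∣B∣≡ [] [] = refl
∣B∣≡ (inside ∷ A) (inside ∷ B) = cong suc (∣B∣≡ A B)
∣B∣≡ (inside ∷ A) (outside ∷ B) = ∣B∣≡ A B
∣B∣≡ (outside ∷ A) (inside ∷ B) = trans (cong suc (∣B∣≡ A B)) (sym (+-suc ∣ A ∩ B ∣ ∣ B ─ A ∣))
∣B∣≡ (outside ∷ A) (outside ∷ B) = ∣B∣≡ A B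

pair-within : ∀ (A B : Subset n) → Within ⊤ (pairPattern A B)
pair-within A B =
  (⊆⊤ , ⊆⊤ , ⊆⊤) ,
  (λ x∈A─B x∈A∩B → x∈p─q⇒x∉q A B x∈A─B (proj₂ (x∈p∩q⁻ A B x∈A∩B))) ,
  (λ x∈A∩B x∈B─A → x∈p─q⇒x∉q B A x∈B─A (proj₁ (x∈p∩q⁻ A B x∈A∩B))) ,
  (λ x∈A─B x∈B─A → x∈p─q⇒x∉q A B x∈A─B (p─q⊆p B A x∈B─A))

binomial : ∀ k l → ((k + l) C k) * (k ! * l !) ≡ (k + l) !
binomial k l = subst (λ d → ((k + l) C k) * (k ! * d !) ≡ (k + l) !) (m+n∸m≡n k l)
  (trans (cong (_* (k ! * (k + l ∸ k) !)) (nCk≡n!/k![n-k]! k≤k+l)) (m/n*n≡m (k![n∸k]!∣n! k≤k+l)))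
  where
  k≤k+l : k ≤ k + l
  k≤k+l = m≤m+n k l
  instance
    nonzero : NonZero (k ! * (k + l ∸ k) !)
    nonzero = k !* (k + l ∸ k) !≢0

pair-orderings : ∀ (A B : Subset n) →
  orderings n ⊤ (just (pairPattern A B)) * ((∣ A ∪ B ∣ C ∣ A ─ B ∣) * (∣ B ∣ C ∣ A ∩ B ∣)) ≡ n !
pair-orderings {n} A B rewrite ∣A∪B∣≡ A B | ∣B∣≡ A B = *-cancelʳ-≡ _ _ (weight P) (begin
  N * (C₁ * C₂) * (a ! * (c ! * b !))     ≡⟨ rearrange N C₁ C₂ (a !) (c ! * b !) ⟩
  N * (C₁ * (a ! * (C₂ * (c ! * b !))))   ≡⟨ cong (λ v → N * (C₁ * (a ! * v))) (binomial c b) ⟩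
  N * (C₁ * (a ! * (c + b) !))            ≡⟨ cong (N *_) (binomial a (c + b)) ⟩
  N * size P !                            ≡⟨ orderings-count n ⊤ P (pair-within A B) (∣⊤∣≡n n) ⟩
  n ! * weight P                          ∎)
  where
  open ≡-Reasoning
  P : Pattern n
  P = pairPattern A B
  N a c b C₁ C₂ : ℕ
  N = orderings n ⊤ (just P)
  a = ∣ A ─ B ∣
  c = ∣ A ∩ B ∣
  b = ∣ B ─ A ∣
  C₁ = (a + (c + b)) C a
  C₂ = (c + b) C c
  rearrange : ∀ N C₁ C₂ f g → N * (C₁ * C₂) * (f * g) ≡ N * (C₁ * (f * (C₂ * g)))
  rearrange = solve-∀
  instance
    weight≢0 : NonZero (a ! * (c ! * b !))
    weight≢0 = m*n≢0 (a !) (c ! * b !) {{a !≢0}} {{c !* b !≢0}}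

-- From counts to the rational sum: all fractions have the denominator n!

module Fractions where

  open import Data.Integer.Base as ℤ using (+_; +≤+)
  import Data.Integer.Properties as ℤ
  open import Data.Rational.Base using (toℚᵘ)
  import Data.Rational.Properties as ℚ
  open import Data.Rational.Unnormalised.Base using (mkℚᵘ; *≡*; *≤*) renaming (_≃_ to _≃ᵘ_)
  import Data.Rational.Unnormalised.Base as ℚᵘ
  import Data.Rational.Unnormalised.Properties as ℚᵘ

  +-common-denominator : ∀ a b d → mkℚᵘ (+ a) d ℚᵘ.+ mkℚᵘ (+ b) d ≃ᵘ mkℚᵘ (+ (a + b)) d
  +-common-denominator a b d = *≡* (begin
    (+ a ℤ.* + D ℤ.+ + b ℤ.* + D) ℤ.* + D     ≡⟨ cong (ℤ._* + D) (cong₂ ℤ._+_ (ℤ.pos-* a D) (ℤ.pos-* b D)) ⟨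
    (+ (a * D) ℤ.+ + (b * D)) ℤ.* + D         ≡⟨ cong (ℤ._* + D) (ℤ.pos-+ (a * D) (b * D)) ⟨
    + (a * D + b * D) ℤ.* + D                 ≡⟨ ℤ.pos-* (a * D + b * D) D ⟨
    + ((a * D + b * D) * D)                   ≡⟨ cong +_ (distribute a b D) ⟩
    + ((a + b) * (D * D))                     ≡⟨ ℤ.pos-* (a + b) (D * D) ⟩
    + (a + b) ℤ.* + (D * D)                   ∎)
    where
    open ≡-Reasoning
    D : ℕ
    D = suc d
    distribute : ∀ a b D → (a * D + b * D) * D ≡ (a + b) * (D * D)
    distribute = solve-∀

  recip-product : ∀ c₁ c₂ N d → N * (c₁ * c₂) ≡ suc d → toℚᵘ (recip c₁ *ℚ recip c₂) ≃ᵘ mkℚᵘ (+ N) d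
  recip-product zero c₂ N d eq = contradiction (trans (sym eq) (*-zeroʳ N)) 1+n≢0
  recip-product (suc c₁) zero N d eq = contradiction (trans (sym eq) (trans (cong (N *_) (*-zeroʳ (suc c₁))) (*-zeroʳ N))) 1+n≢0
  recip-product (suc c₁) (suc c₂) N d eq =
    ℚᵘ.≃-trans (ℚ.toℚᵘ-homo-* (recip (suc c₁)) (recip (suc c₂)))
      (ℚᵘ.≃-trans (ℚᵘ.*-cong (ℚ.toℚᵘ-fromℚᵘ (mkℚᵘ (+ 1) c₁)) (ℚ.toℚᵘ-fromℚᵘ (mkℚᵘ (+ 1) c₂)))
        (*≡* (begin
          + 1 ℤ.* + 1 ℤ.* + suc d       ≡⟨ ℤ.*-identityˡ (+ suc d) ⟩
          + suc d                        ≡⟨ cong +_ eq ⟨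
          + (N * (suc c₁ * suc c₂))      ≡⟨ ℤ.pos-* N (suc c₁ * suc c₂) ⟩
          + N ℤ.* + (suc c₁ * suc c₂)    ∎)))
    where open ≡-Reasoning

  ∑-as-fraction : ∀ m (f : Fin m → ℚ) (N : Fin m → ℕ) d →
    (∀ i → toℚᵘ (f i) ≃ᵘ mkℚᵘ (+ N i) d) → toℚᵘ (∑ m f) ≃ᵘ mkℚᵘ (+ sum N) d
  ∑-as-fraction zero f N d f≃N = *≡* refl
  ∑-as-fraction (suc m) f N d f≃N =
    ℚᵘ.≃-trans (ℚ.toℚᵘ-homo-+ (f zero) (∑ m (λ i → f (suc i))))
      (ℚᵘ.≃-trans (ℚᵘ.+-cong (f≃N zero) (∑-as-fraction m (λ i → f (suc i)) (λ i → N (suc i)) d (λ i → f≃N (suc i))))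
        (+-common-denominator (N zero) (sum (λ i → N (suc i))) d))

  fractions≤1 : ∀ m (f : Fin m → ℚ) (N : Fin m → ℕ) d →
    (∀ i → toℚᵘ (f i) ≃ᵘ mkℚᵘ (+ N i) d) → sum N ≤ suc d → ∑ m f ≤ℚ 1ℚ
  fractions≤1 m f N d f≃N ∑N≤1+d =
    ℚ.toℚᵘ-cancel-≤ (ℚᵘ.≤-respˡ-≃ (ℚᵘ.≃-sym (∑-as-fraction m f N d f≃N)) (*≤* cross))
    where
    cross : + sum N ℤ.* + 1 ℤ.≤ + 1 ℤ.* + suc d
    cross = subst₂ ℤ._≤_ (sym (ℤ.*-identityʳ (+ sum N))) (sym (ℤ.*-identityˡ (+ suc d))) (ℤ.+≤+ ∑N≤1+d)

theorem1p9 : (t n m : ℕ) → 1 ≤ t → (A B : Fin m → Subset n) →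
    (∀ i → ∣ A i ∩ B i ∣ ≤ t) →
    (∀ i j → i ≢ j → ∣ A i ∩ B j ∣ ≥ t) →
    (∀ i j → i ≢ j → A i ∩ B i ≡ A j ∩ B j →
      ¬ ((A i ∩ B j ≡ A i ∩ B i) × (A i ∩ B i ≡ A j ∩ B i))) →
    ∑ m (λ i → recip (∣ A i ∪ B i ∣ C ∣ A i ─ B i ∣) *ℚ recip (∣ B i ∣ C ∣ A i ∩ B i ∣)) ≤ℚ 1ℚ
theorem1p9 t n m 1≤t A B small large not-forbidden =
  Fractions.fractions≤1 m _ count d
    (λ i → Fractions.recip-product (∣ A i ∪ B i ∣ C ∣ A i ─ B i ∣) (∣ B i ∣ C ∣ A i ∩ B i ∣) (count i) d
             (trans (pair-orderings (A i) (B i)) n!≡1+d))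
    (subst (sum count ≤_) n!≡1+d disjoint)
  where
  count : Fin m → ℕ
  count i = orderings n ⊤ (just (pairPattern (A i) (B i)))
  d : ℕ
  d = pred (n !)
  n!≡1+d : n ! ≡ suc d
  n!≡1+d = sym (suc-pred (n !) {{n !≢0}})
  disjoint : sum count ≤ n !
  disjoint = orderings-exclusive n ⊤ (∣⊤∣≡n n) _ (pairs-exclusive 1≤t A B small large not-forbidden)
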